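{- Let $q$ be an odd prime power, $G=\left\{\left(\begin{smallmatrix}1&x&z\\0&1&y\\0&0&1\end{smallmatrix}\right):x,y,z\in\mathbb{F}_q\right\}$, $Z=\left\{\left(\begin{smallmatrix}1&0&z\\0&1&0\\0&0&1\end{smallmatrix}\right):z\in\mathbb{F}_q\right\}$, $\varepsilon\in\mathbb{F}_q$ a nonsquare, and $K=\{\varphi_{\alpha,\beta}:\alpha,\beta\in\mathbb{F}_q,(\alpha,\beta)\neq(0,0)\}\leq\operatorname{Aut}(G)$, where $$\varphi_{\alpha,\beta}\left(\left(\begin{smallmatrix}1&x&z\\0&1&y\\0&0&1\end{smallmatrix}\right)\right)=\left(\begin{smallmatrix}1&\alpha x+\varepsilon\beta y&\alpha\beta(\frac{x^2}{2}+\varepsilon\frac{y^2}{2})+\varepsilon\beta^2xy+(\alpha^2-\varepsilon\beta^2)z\\0&1&\beta x+\alpha y\\0&0&1\end{smallmatrix}\right).$$ Then (1) $Z\setminus\{e\}$ is a single $K$-orbit; (2) for every $K$-orbit $X$ contained in $G\setminus Z$, the set $X\cup\{e\}$ is a transversal for $Z$ in $G$; in particular $|X|=q^2-1$.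
   Context: $e$ denotes the identity matrix. -}

module Defs where

open import Level using (Level; _⊔_)
open import Algebra.Bundles using (CommutativeRing)
open import Data.Nat using (ℕ)
open import Data.Fin using (Fin)
open import Data.Product using (Σ; ∃; _×_; _,_; proj₁)
open import Data.Sum using (_⊎_)
open import Relation.Nullary using (¬_)
open import Relation.Binary.Bundles using (Setoid)
import Relation.Binary.PropositionalEquality as ≡
open import Function.Bundles using (Inverse; _⇔_)

record IsField {c ℓ : Level} (R : CommutativeRing c ℓ) : Set (c ⊔ ℓ) where
  open CommutativeRing R
  field
    1≉0 : ¬ (1# ≈ 0#)
    inverse : ∀ x → ¬ (x ≈ 0#) → ∃ λ y → x * y ≈ 1#

HasOrder : {c ℓ : Level} → CommutativeRing c ℓ → ℕ → Set (c ⊔ ℓ)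
HasOrder R q = Inverse (≡.setoid (Fin q)) (CommutativeRing.setoid R)

module Heisenberg {c ℓ : Level} (R : CommutativeRing c ℓ) (F : IsField R)
         (2≉0 : ¬ (CommutativeRing._≈_ R (CommutativeRing._+_ R (CommutativeRing.1# R) (CommutativeRing.1# R)) (CommutativeRing.0# R)))
         (ε : CommutativeRing.Carrier R) where
  open CommutativeRing R

  half : Carrier
  half = proj₁ (IsField.inverse F (1# + 1#) 2≉0)

  -- The matrix [[1,x,z],[0,1,y],[0,0,1]] is represented by the triple (x , y , z).
  record G : Set c where
    constructor mat
    field
      gx gy gz : Carrier
  open G public

  _≈G_ : G → G → Set ℓ
  g ≈G h = (gx g ≈ gx h) × (gy g ≈ gy h) × (gz g ≈ gz h)

  _·_ : G → G → G
  mat x y z · mat x' y' z' = mat (x + x') (y + y') (z + z' + x * y')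

  e : G
  e = mat 0# 0# 0#

  InZ : G → Set ℓ
  InZ g = (gx g ≈ 0#) × (gy g ≈ 0#)

  φ : Carrier → Carrier → G → G
  φ α β (mat x y z) =
    mat (α * x + ε * β * y)
        (β * x + α * y)
        (α * β * (x * x * half + ε * (y * y * half)) + ε * (β * β) * (x * y)
           + (α * α - ε * (β * β)) * z)

  NonZeroPair : Carrier → Carrier → Set ℓ
  NonZeroPair α β = ¬ ((α ≈ 0#) × (β ≈ 0#))

  InOrbit : G → G → Set (c ⊔ ℓ)
  InOrbit g h = Σ Carrier λ α → Σ Carrier λ β → NonZeroPair α β × (φ α β g ≈G h)

  InCoset : G → G → Set (c ⊔ ℓ)
  InCoset g t = Σ G λ z → InZ z × (t ≈G (g · z))

  IsTransversal : {p : Level} → (G → Set p) → Set (c ⊔ ℓ ⊔ p)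
  IsTransversal T =
    ∀ g → (Σ G λ t → T t × InCoset g t)
        × (∀ t t' → T t → T t' → InCoset g t → InCoset g t' → t ≈G t')

  OrbitWithE : G → G → Set (c ⊔ ℓ)
  OrbitWithE g h = InOrbit g h ⊎ Lift c (h ≈G e)
    where open import Level using (Lift)

  SubSetoid : {p : Level} → (G → Set p) → Setoid (c ⊔ p) ℓ
  SubSetoid P = record
    { Carrier = Σ G P
    ; _≈_ = λ a b → proj₁ a ≈G proj₁ b
    ; isEquivalence = record
      { refl = refl , refl , refl
      ; sym = λ { (p , q , r) → sym p , sym q , sym r }
      ; trans = λ { (p , q , r) (p' , q' , r') → trans p p' , trans q q' , trans r r' }
      }
    }

  HasSize : {p : Level} → (G → Set p) → ℕ → Set (c ⊔ ℓ ⊔ p)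
  HasSize P n = Inverse (≡.setoid (Fin n)) (SubSetoid P)

{-# OPTIONS --safe #-}
-- The automorphism φ α β acts on G/Z ≅ F² as multiplication by α + β√ε in the quadratic
-- extension F(√ε), which is a field because ε is a nonsquare, and on Z as multiplication by
-- the norm α² − εβ².  (1) So the orbit of a nontrivial central element consists of its
-- multiples by norms of nonzero elements, and in a finite field every element is a norm
-- (by a counting argument), so that orbit is Z ∖ {e}.  (2) If the orbit of g misses Z then
-- w = x + y√ε ≠ 0 for g = (x, y, z); multiplication by w permutes F(√ε) ∖ {0}, so the orbit
-- meets every coset gZ ≠ Z exactly once, and α + β√ε ↦ φ α β g is a bijection from the
-- q² − 1 nonzero pairs onto the orbit.
module Submission where

open import Defs
open import Level using (Level; _⊔_; lift)
open import Algebra.Bundles using (CommutativeRing)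
open import Algebra.Solver.Ring.AlmostCommutativeRing using (fromCommutativeRing; _-Raw-AlmostCommutative⟶_)
open import Data.Empty using (⊥; ⊥-elim)
open import Data.Fin.Base as Fin using (Fin; punchIn; punchOut)
import Data.Fin.Properties as Fin
open import Data.Integer.Base as ℤ using (ℤ; +_; -[1+_]; _⊖_; _◃_; sign; ∣_∣; +-*-rawRing)
import Data.Integer.Properties as ℤ
open import Data.Maybe.Base using (Maybe; just; nothing)
open import Data.Nat.Base as ℕ using (ℕ; zero; suc)
import Data.Nat.Properties as ℕ
open import Data.Product.Base using (Σ; ∃; _×_; _,_; proj₁; proj₂)
open import Data.Product.Function.NonDependent.Setoid using (_×-inverse_)
open import Data.Product.Relation.Binary.Pointwise.NonDependent using (Pointwise; _×ₛ_; Pointwise-≡↔≡)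
open import Data.Sign.Base as Sign using (Sign)
open import Data.Sum.Base using (_⊎_; inj₁; inj₂)
open import Function.Base using (_∘′_)
open import Function.Bundles using (Inverse; _⇔_; mk⇔)
open import Function.Definitions using (Injective)
import Function.Construct.Composition as Compose
import Function.Construct.Symmetry as Symmetry
open import Relation.Binary.Bundles using (Setoid)
open import Relation.Binary.Definitions using (Decidable)
import Relation.Binary.Construct.On as On
open import Relation.Nullary using (¬_; Dec; yes; no)
open import Relation.Nullary.Decidable using (map′; _×-dec_)
import Relation.Binary.PropositionalEquality as ≡
open ≡ using (_≡_; _≢_)

-- The ring solver decides identities by normalising, which needs decidable equality of
-- coefficients; taking the coefficients in ℤ, which maps into every commutative ring, makes
-- it work for an abstract commutative ring.
module CommutativeRingSolver {c ℓ} (R : CommutativeRing c ℓ) where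
  open CommutativeRing R
  open import Algebra.Properties.Ring ring using (-‿involutive; -0#≈0#; -‿+-comm; -1*x≈-x)
  open import Algebra.Properties.Semiring.Mult.TCOptimised semiring
    using (×-homo-+; ×1-homo-*; 1+×) renaming (_×_ to _·_)
  open import Algebra.Properties.CommutativeSemigroup +-commutativeSemigroup
    using () renaming (interchange to +-interchange)
  open import Algebra.Properties.CommutativeSemigroup *-commutativeSemigroup
    using () renaming (interchange to *-interchange)
  open import Relation.Binary.Reasoning.Setoid setoid

  ⟦_⟧ℤ : ℤ → Carrier
  ⟦ + n ⟧ℤ      = n · 1#
  ⟦ -[1+ n ] ⟧ℤ = - (suc n · 1#)

  ⟦_⟧± : Sign → Carrier
  ⟦ Sign.+ ⟧± = 1#
  ⟦ Sign.- ⟧± = - 1#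

  [a+x]-[a+y]≈x-y : ∀ a x y → (a + x) - (a + y) ≈ x - y
  [a+x]-[a+y]≈x-y a x y = begin
    (a + x) - (a + y)     ≈⟨ +-congˡ (-‿+-comm a y) ⟨
    (a + x) + (- a + - y) ≈⟨ +-interchange a x (- a) (- y) ⟩
    (a - a) + (x - y)     ≈⟨ +-congʳ (-‿inverseʳ a) ⟩
    0# + (x - y)          ≈⟨ +-identityˡ (x - y) ⟩
    x - y                 ∎

  ⊖-homo : ∀ m n → ⟦ m ⊖ n ⟧ℤ ≈ m · 1# - n · 1#
  ⊖-homo m       zero    = sym (trans (+-congˡ -0#≈0#) (+-identityʳ _))
  ⊖-homo zero    (suc n) = sym (+-identityˡ _)
  ⊖-homo (suc m) (suc n) = begin
    ⟦ suc m ⊖ suc n ⟧ℤ              ≡⟨ ≡.cong ⟦_⟧ℤ (ℤ.[1+m]⊖[1+n]≡m⊖n m n) ⟩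
    ⟦ m ⊖ n ⟧ℤ                      ≈⟨ ⊖-homo m n ⟩
    m · 1# - n · 1#                 ≈⟨ [a+x]-[a+y]≈x-y 1# (m · 1#) (n · 1#) ⟨
    (1# + m · 1#) - (1# + n · 1#)   ≈⟨ +-cong (1+× m 1#) (-‿cong (1+× n 1#)) ⟨
    suc m · 1# - suc n · 1#         ∎

  +-homo : ∀ i j → ⟦ i ℤ.+ j ⟧ℤ ≈ ⟦ i ⟧ℤ + ⟦ j ⟧ℤ
  +-homo -[1+ m ] -[1+ n ] = begin
    - (suc (suc (m ℕ.+ n)) · 1#)    ≡⟨ ≡.cong (λ k → - (k · 1#)) (ℕ.+-suc (suc m) n) ⟨
    - ((suc m ℕ.+ suc n) · 1#)      ≈⟨ -‿cong (×-homo-+ 1# (suc m) (suc n)) ⟩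
    - (suc m · 1# + suc n · 1#)     ≈⟨ -‿+-comm _ _ ⟨
    - (suc m · 1#) + - (suc n · 1#) ∎
  +-homo -[1+ m ] (+ n)    = trans (⊖-homo n (suc m)) (+-comm _ _)
  +-homo (+ m)    -[1+ n ] = ⊖-homo m (suc n)
  +-homo (+ m)    (+ n)    = ×-homo-+ 1# m n

  -‿homo : ∀ i → ⟦ ℤ.- i ⟧ℤ ≈ - ⟦ i ⟧ℤ
  -‿homo (+ zero)  = sym -0#≈0#
  -‿homo (+ suc n) = refl
  -‿homo -[1+ n ]  = sym (-‿involutive _)

  ◃-homo : ∀ s n → ⟦ s ◃ n ⟧ℤ ≈ ⟦ s ⟧± * n · 1#
  ◃-homo s      zero    = sym (zeroʳ _)
  ◃-homo Sign.+ (suc n) = sym (*-identityˡ _)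
  ◃-homo Sign.- (suc n) = sym (-1*x≈-x _)

  sign-homo : ∀ s t → ⟦ s Sign.* t ⟧± ≈ ⟦ s ⟧± * ⟦ t ⟧±
  sign-homo Sign.+ t      = sym (*-identityˡ _)
  sign-homo Sign.- Sign.+ = sym (*-identityʳ _)
  sign-homo Sign.- Sign.- = sym (trans (-1*x≈-x _) (-‿involutive _))

  sign-abs-homo : ∀ i → ⟦ i ⟧ℤ ≈ ⟦ sign i ⟧± * ∣ i ∣ · 1#
  sign-abs-homo i = trans (reflexive (≡.cong ⟦_⟧ℤ (≡.sym (ℤ.◃-inverse i)))) (◃-homo (sign i) ∣ i ∣)

  *-homo : ∀ i j → ⟦ i ℤ.* j ⟧ℤ ≈ ⟦ i ⟧ℤ * ⟦ j ⟧ℤ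
  *-homo i j = begin
    ⟦ sign i Sign.* sign j ◃ ∣ i ∣ ℕ.* ∣ j ∣ ⟧ℤ
      ≈⟨ ◃-homo (sign i Sign.* sign j) (∣ i ∣ ℕ.* ∣ j ∣) ⟩
    ⟦ sign i Sign.* sign j ⟧± * (∣ i ∣ ℕ.* ∣ j ∣) · 1#
      ≈⟨ *-cong (sign-homo (sign i) (sign j)) (×1-homo-* ∣ i ∣ ∣ j ∣) ⟩
    (⟦ sign i ⟧± * ⟦ sign j ⟧±) * (∣ i ∣ · 1# * ∣ j ∣ · 1#)
      ≈⟨ *-interchange _ _ _ _ ⟩
    (⟦ sign i ⟧± * ∣ i ∣ · 1#) * (⟦ sign j ⟧± * ∣ j ∣ · 1#)
      ≈⟨ *-cong (sign-abs-homo i) (sign-abs-homo j) ⟨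
    ⟦ i ⟧ℤ * ⟦ j ⟧ℤ
      ∎

  ℤ⟶R : +-*-rawRing -Raw-AlmostCommutative⟶ fromCommutativeRing R
  ℤ⟶R = record
    { ⟦_⟧    = ⟦_⟧ℤ
    ; +-homo = +-homo
    ; *-homo = *-homo
    ; -‿homo = -‿homo
    ; 0-homo = refl
    ; 1-homo = refl
    }

  ℤ-equality-transfer : ∀ i j → Maybe (⟦ i ⟧ℤ ≈ ⟦ j ⟧ℤ)
  ℤ-equality-transfer i j with i ℤ.≟ j
  ... | yes i≡j = just (reflexive (≡.cong ⟦_⟧ℤ i≡j))
  ... | no _    = nothing

  open import Algebra.Solver.Ring +-*-rawRing (fromCommutativeRing R) ℤ⟶R ℤ-equality-transfer public

  :0 :1 : ∀ {n} → Polynomial n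
  :0 = con (+ 0)
  :1 = con (+ 1)

module FieldProperties {c ℓ} (R : CommutativeRing c ℓ) (F : IsField R) where
  open CommutativeRing R
  open IsField F
  open CommutativeRingSolver R
  open import Algebra.Properties.Ring ring using (x∙y⁻¹≈ε⇒x≈y; x≈y⇒x∙y⁻¹≈ε; +-inverseˡ-unique)
  open import Relation.Binary.Reasoning.Setoid setoid

  *-inverse-cancel : ∀ {a b} → a * b ≈ 1# → ∀ u → b * (a * u) ≈ u
  *-inverse-cancel {a} {b} ab≈1 u = begin
    b * (a * u) ≈⟨ solve 3 (λ a b u → b :* (a :* u) := (a :* b) :* u) refl a b u ⟩
    (a * b) * u ≈⟨ *-congʳ ab≈1 ⟩
    1# * u      ≈⟨ *-identityˡ u ⟩
    u           ∎

  *-cancelˡ : ∀ a {u w} → ¬ a ≈ 0# → a * u ≈ a * w → u ≈ w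
  *-cancelˡ a {u} {w} a≉0 au≈aw = begin
    u             ≈⟨ *-inverse-cancel a*a⁻¹≈1 u ⟨
    a⁻¹ * (a * u) ≈⟨ *-congˡ au≈aw ⟩
    a⁻¹ * (a * w) ≈⟨ *-inverse-cancel a*a⁻¹≈1 w ⟩
    w             ∎
    where
    a⁻¹ = proj₁ (inverse a a≉0)
    a*a⁻¹≈1 = proj₂ (inverse a a≉0)

  module _ (_≟_ : Decidable _≈_) where

    x*y≈0⇒x≈0∨y≈0 : ∀ x y → x * y ≈ 0# → x ≈ 0# ⊎ y ≈ 0#
    x*y≈0⇒x≈0∨y≈0 x y xy≈0 with x ≟ 0#
    ... | yes x≈0 = inj₁ x≈0
    ... | no x≉0  = inj₂ (*-cancelˡ x x≉0 (trans xy≈0 (sym (zeroʳ x))))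

    x*x≈0⇒x≈0 : ∀ x → x * x ≈ 0# → x ≈ 0#
    x*x≈0⇒x≈0 x xx≈0 with x*y≈0⇒x≈0∨y≈0 x x xx≈0
    ... | inj₁ x≈0 = x≈0
    ... | inj₂ x≈0 = x≈0

    x*x≈y*y⇒x≈±y : ∀ x y → x * x ≈ y * y → x ≈ y ⊎ x ≈ - y
    x*x≈y*y⇒x≈±y x y xx≈yy with x*y≈0⇒x≈0∨y≈0 (x - y) (x + y) difference-of-squares
      where
      difference-of-squares : (x - y) * (x + y) ≈ 0#
      difference-of-squares = trans
        (solve 2 (λ x y → (x :- y) :* (x :+ y) := x :* x :- y :* y) refl x y)
        (x≈y⇒x∙y⁻¹≈ε xx≈yy)
    ... | inj₁ x-y≈0 = inj₁ (x∙y⁻¹≈ε⇒x≈y x y x-y≈0)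
    ... | inj₂ x+y≈0 = inj₂ (+-inverseˡ-unique x y x+y≈0)

endo-injective⇒¬avoids : ∀ {n} (f : Fin n → Fin n) → Injective _≡_ _≡_ f →
                         ∀ t → ¬ (∀ i → f i ≢ t)
endo-injective⇒¬avoids {suc n} f f-injective t avoids = Fin.<⇒notInjective (ℕ.n<1+n n) shrunk-injective
  where
  shrunk : Fin (suc n) → Fin n
  shrunk i = punchOut {i = t} {j = f i} (λ t≡fi → avoids i (≡.sym t≡fi))

  shrunk-injective : Injective _≡_ _≡_ shrunk
  shrunk-injective = f-injective ∘′ Fin.punchOut-injective {i = t} _ _

_∖_ : ∀ {a ℓ} (S : Setoid a ℓ) → Setoid.Carrier S → Setoid (a ⊔ ℓ) ℓ
S ∖ p = On.setoid S (proj₁ {B = λ x → ¬ Setoid._≈_ S x p})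

module FiniteSetoid {a ℓ n} {S : Setoid a ℓ} (I : Inverse (≡.setoid (Fin n)) S) where
  open Setoid S
  open Inverse I

  from-injective : ∀ {x y} → from x ≡ from y → x ≈ y
  from-injective {x} {y} fx≡fy = trans (sym (strictlyInverseˡ x)) (inverseˡ fx≡fy)

  infix 4 _≟_
  _≟_ : Decidable _≈_
  x ≟ y = map′ from-injective from-cong (from x Fin.≟ from y)

  injective⇒¬avoids : (h : Carrier → Carrier) → (∀ {x y} → h x ≈ h y → x ≈ y) →
                      ∀ c → ¬ (∀ x → ¬ h x ≈ c)
  injective⇒¬avoids h h-injective c avoids =
    endo-injective⇒¬avoids hᶠ hᶠ-injective (from c) (λ i hᶠi≡c → avoids (to i) (from-injective hᶠi≡c))
    where
    hᶠ : Fin n → Fin n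
    hᶠ i = from (h (to i))

    hᶠ-injective : Injective _≡_ _≡_ hᶠ
    hᶠ-injective {i} {j} hᶠi≡hᶠj =
      ≡.trans (≡.sym (strictlyInverseʳ i))
        (≡.trans (from-cong (h-injective (from-injective hᶠi≡hᶠj))) (strictlyInverseʳ j))

punch-inverse : ∀ {a ℓ n} {S : Setoid a ℓ} → Inverse (≡.setoid (Fin (suc n))) S → ∀ p →
                Inverse (≡.setoid (Fin n)) (S ∖ p)
punch-inverse {S = S} I p = record
  { to        = λ i → to (punchIn j i) , to-punchIn≉p i
  ; from      = λ x → punchOut (from≢j (proj₂ x))
  ; to-cong   = λ i≡i' → reflexive (≡.cong (to ∘′ punchIn j) i≡i')
  ; from-cong = λ x≈y → Fin.punchOut-cong j (from-cong x≈y)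
  ; inverse   = (λ { {x , _} ≡.refl →
                    trans (reflexive (≡.cong to (Fin.punchIn-punchOut _))) (strictlyInverseˡ x) })
              , (λ {i} x≈toi →
                    ≡.trans (Fin.punchOut-cong j (≡.trans (from-cong x≈toi) (strictlyInverseʳ _)))
                            (Fin.punchOut-punchIn j))
  }
  where
  open Setoid S
  open Inverse I
  open FiniteSetoid I using (from-injective)
  j = from p

  to-punchIn≉p : ∀ i → ¬ to (punchIn j i) ≈ p
  to-punchIn≉p i to≈p = Fin.punchInᵢ≢i j i (≡.trans (≡.sym (strictlyInverseʳ _)) (from-cong to≈p))

  from≢j : ∀ {x} → ¬ x ≈ p → j ≢ from x
  from≢j x≉p j≡fx = x≉p (from-injective (≡.sym j≡fx))

square-inverse : ∀ {a ℓ n} {S : Setoid a ℓ} → Inverse (≡.setoid (Fin n)) S →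
                 Inverse (≡.setoid (Fin (n ℕ.* n))) (S ×ₛ S)
square-inverse I = Compose.inverse Fin.*↔× (Compose.inverse (Symmetry.inverse Pointwise-≡↔≡) (I ×-inverse I))

punctured-square-inverse : ∀ {a ℓ n} {S : Setoid a ℓ} → Inverse (≡.setoid (Fin n)) S → ∀ p →
                           Inverse (≡.setoid (Fin (n ℕ.* n ℕ.∸ 1))) ((S ×ₛ S) ∖ p)
punctured-square-inverse {n = zero}  I p with Inverse.from I (proj₁ p)
... | ()
punctured-square-inverse {n = suc n} I p = punch-inverse (square-inverse I) p

module QuadraticExtension {c ℓ} (R : CommutativeRing c ℓ) (F : IsField R) (ε : CommutativeRing.Carrier R) where
  open CommutativeRing R
  open IsField F
  open CommutativeRingSolver R
  open FieldProperties R F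
  open import Algebra.Properties.Ring ring using (x∙y⁻¹≈ε⇒x≈y; +-cancelˡ; -‿involutive; -0#≈0#)
  open import Relation.Binary.Reasoning.Setoid setoid

  infix 4 _≈²_
  _≈²_ : Carrier × Carrier → Carrier × Carrier → Set ℓ
  _≈²_ = Pointwise _≈_ _≈_

  module ² = Setoid (setoid ×ₛ setoid)

  -- (α , β) ⊙ (x , y) is the product (α + β√ε)(x + y√ε) in F[t]/(t² − ε).
  infixl 7 _⊙_
  _⊙_ : Carrier × Carrier → Carrier × Carrier → Carrier × Carrier
  (α , β) ⊙ (x , y) = α * x + ε * β * y , β * x + α * y

  norm : Carrier × Carrier → Carrier
  norm (x , y) = x * x - ε * (y * y)

  ⊙-congʳ : ∀ {u u'} w → u ≈² u' → u ⊙ w ≈² u' ⊙ w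
  ⊙-congʳ w (α≈α' , β≈β') =
    +-cong (*-congʳ α≈α') (*-congʳ (*-congˡ β≈β')) , +-cong (*-congʳ β≈β') (*-congʳ α≈α')

  ⊙-identityˡ : ∀ w → (1# , 0#) ⊙ w ≈² w
  ⊙-identityˡ (x , y) =
    solve 3 (λ ε x y → :1 :* x :+ ε :* :0 :* y := x) refl ε x y ,
    solve 2 (λ x y → :0 :* x :+ :1 :* y := y) refl x y

  ≈²0⇒norm≈0 : ∀ {u} → u ≈² (0# , 0#) → norm u ≈ 0#
  ≈²0⇒norm≈0 {α , β} (α≈0 , β≈0) =
    trans (+-cong (*-cong α≈0 α≈0) (-‿cong (*-congˡ (*-cong β≈0 β≈0))))
    (solve 1 (λ ε → :0 :* :0 :- ε :* (:0 :* :0) := :0) refl ε)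

  ⊙-zeroˡ : ∀ w → (0# , 0#) ⊙ w ≈² (0# , 0#)
  ⊙-zeroˡ (x , y) =
    solve 3 (λ ε x y → :0 :* x :+ ε :* :0 :* y := :0) refl ε x y ,
    solve 2 (λ x y → :0 :* x :+ :0 :* y := :0) refl x y

  conj : Carrier × Carrier → Carrier × Carrier
  conj (x , y) = x , - y

  ⊙-conj : ∀ u w → u ⊙ w ⊙ conj w ≈² (norm w * proj₁ u , norm w * proj₂ u)
  ⊙-conj (α , β) (x , y) =
    solve 5 (λ ε α β x y → (α :* x :+ ε :* β :* y) :* x :+ ε :* (β :* x :+ α :* y) :* (:- y)
                           := (x :* x :- ε :* (y :* y)) :* α) refl ε α β x y ,
    solve 5 (λ ε α β x y → (β :* x :+ α :* y) :* x :+ (α :* x :+ ε :* β :* y) :* (:- y)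
                           := (x :* x :- ε :* (y :* y)) :* β) refl ε α β x y

  module _ (w : Carrier × Carrier) (norm≉0 : ¬ norm w ≈ 0#) where
    private
      N⁻¹ = proj₁ (inverse (norm w) norm≉0)
      N*N⁻¹≈1 = proj₂ (inverse (norm w) norm≉0)

    ⊙-cancelʳ : ∀ {u u'} → u ⊙ w ≈² u' ⊙ w → u ≈² u'
    ⊙-cancelʳ {u} {u'} uw≈u'w =
      *-cancelˡ (norm w) norm≉0 (proj₁ Nu≈Nu') , *-cancelˡ (norm w) norm≉0 (proj₂ Nu≈Nu')
      where
      Nu≈Nu' = ².trans (².sym (⊙-conj u w)) (².trans (⊙-congʳ (conj w) uw≈u'w) (⊙-conj u' w))

    ⊙-solvableʳ : ∀ v → ∃ λ u → u ⊙ w ≈² v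
    ⊙-solvableʳ v@(a , b) = (N⁻¹ * proj₁ (v ⊙ conj w) , N⁻¹ * proj₂ (v ⊙ conj w)) ,
      trans (solve 6 (λ ε N⁻¹ a b x y →
               N⁻¹ :* (a :* x :+ ε :* b :* (:- y)) :* x :+ ε :* (N⁻¹ :* (b :* x :+ a :* (:- y))) :* y
               := N⁻¹ :* ((x :* x :- ε :* (y :* y)) :* a)) refl ε N⁻¹ a b x y)
            (*-inverse-cancel N*N⁻¹≈1 a) ,
      trans (solve 6 (λ ε N⁻¹ a b x y →
               N⁻¹ :* (b :* x :+ a :* (:- y)) :* x :+ N⁻¹ :* (a :* x :+ ε :* b :* (:- y)) :* y
               := N⁻¹ :* ((x :* x :- ε :* (y :* y)) :* b)) refl ε N⁻¹ a b x y)
            (*-inverse-cancel N*N⁻¹≈1 b)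
      where
      x = proj₁ w
      y = proj₂ w

  module _ (ε-nonsquare : ¬ ∃ λ y → y * y ≈ ε) where

    ε≉0 : ¬ ε ≈ 0#
    ε≉0 ε≈0 = ε-nonsquare (0# , trans (zeroˡ 0#) (sym ε≈0))

    norm≈0⇒≈0 : (_≟_ : Decidable _≈_) → ∀ {u} → norm u ≈ 0# → u ≈² (0# , 0#)
    norm≈0⇒≈0 _≟_ {α , β} N≈0 with β ≟ 0#
    ... | yes β≈0 = x*x≈0⇒x≈0 _≟_ α (begin
          α * α        ≈⟨ x∙y⁻¹≈ε⇒x≈y _ _ N≈0 ⟩
          ε * (β * β)  ≈⟨ *-congˡ (*-congʳ β≈0) ⟩
          ε * (0# * β) ≈⟨ solve 2 (λ ε β → ε :* (:0 :* β) := :0) refl ε β ⟩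
          0#           ∎) , β≈0
    ... | no β≉0 = ⊥-elim (ε-nonsquare (α * β⁻¹ , (begin
          (α * β⁻¹) * (α * β⁻¹)
            ≈⟨ solve 2 (λ α β⁻¹ → (α :* β⁻¹) :* (α :* β⁻¹) := (α :* α) :* (β⁻¹ :* β⁻¹)) refl α β⁻¹ ⟩
          (α * α) * (β⁻¹ * β⁻¹)
            ≈⟨ *-congʳ (x∙y⁻¹≈ε⇒x≈y _ _ N≈0) ⟩
          (ε * (β * β)) * (β⁻¹ * β⁻¹)
            ≈⟨ solve 3 (λ ε β β⁻¹ → (ε :* (β :* β)) :* (β⁻¹ :* β⁻¹) := ε :* ((β :* β⁻¹) :* (β :* β⁻¹)))
                 refl ε β β⁻¹ ⟩
          ε * ((β * β⁻¹) * (β * β⁻¹))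
            ≈⟨ *-congˡ (*-cong ββ⁻¹≈1 ββ⁻¹≈1) ⟩
          ε * (1# * 1#)
            ≈⟨ solve 1 (λ ε → ε :* (:1 :* :1) := ε) refl ε ⟩
          ε ∎)))
      where
      β⁻¹ = proj₁ (inverse β β≉0)
      ββ⁻¹≈1 = proj₂ (inverse β β≉0)

  module _ {q} (ord : HasOrder R q) (ε≉0 : ¬ ε ≈ 0#) where
    open Inverse ord using (to; from; from-cong; strictlyInverseˡ)
    open FiniteSetoid ord using (_≟_; from-injective; injective⇒¬avoids)

    private
      Rep : Carrier → Set
      Rep x = from x Fin.≤ from (- x)

      Rep? : ∀ x → Dec (Rep x)
      Rep? x = from x Fin.≤? from (- x)

      -x≈y : ∀ {x y} → x ≈ - y → - x ≈ y
      -x≈y {x} {y} x≈-y = trans (-‿cong x≈-y) (-‿involutive y)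

      Rep-unique : ∀ {x y} → x ≈ - y → Rep x → Rep y → x ≈ y
      Rep-unique {x} {y} x≈-y x-rep y-rep = from-injective (Fin.≤-antisym
        (≡.subst (from x Fin.≤_) (from-cong (-x≈y x≈-y)) x-rep)
        (≡.subst (from y Fin.≤_) (from-cong (sym x≈-y)) y-rep))

      ¬Rep-both : ∀ {x y} → x ≈ - y → ¬ Rep x → ¬ Rep y → ⊥
      ¬Rep-both {x} {y} x≈-y x-nonrep y-nonrep = Fin.<-asym
        (≡.subst (Fin._< from x) (from-cong (-x≈y x≈-y)) (ℕ.≰⇒> x-nonrep))
        (≡.subst (Fin._< from y) (from-cong (sym x≈-y)) (ℕ.≰⇒> y-nonrep))

      Rep-0 : ∀ {x} → x ≈ 0# → Rep x
      Rep-0 x≈0 = Fin.≤-reflexive (from-cong (trans x≈0 (trans (sym -0#≈0#) (-‿cong (sym x≈0)))))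

    -- If c were not a norm, then x ↦ x² on the member of each pair {x, − x} with the smaller
    -- index (Rep) and x ↦ c + εx² on the other would be an injective self-map of F missing c.
    norm-covers : ∀ c → ¬ (∀ a b → ¬ a * a ≈ c + ε * (b * b))
    norm-covers c non-norm = injective⇒¬avoids h h-injective c h-avoids-c
      where
      h : Carrier → Carrier
      h x with Rep? x
      ... | yes _ = x * x
      ... | no _  = c + ε * (x * x)

      ±-unique : ∀ {x y} → x * x ≈ y * y → (Rep x → Rep y → x ≈ y) × (¬ Rep x → ¬ Rep y → x ≈ y)
      ±-unique {x} {y} xx≈yy with x*x≈y*y⇒x≈±y _≟_ x y xx≈yy
      ... | inj₁ x≈y  = (λ _ _ → x≈y) , (λ _ _ → x≈y)
      ... | inj₂ x≈-y = Rep-unique x≈-y , λ x-nonrep y-nonrep → ⊥-elim (¬Rep-both x≈-y x-nonrep y-nonrep)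

      h-injective : ∀ {x y} → h x ≈ h y → x ≈ y
      h-injective {x} {y} hx≈hy with Rep? x | Rep? y
      ... | yes x-rep    | yes y-rep    = proj₁ (±-unique hx≈hy) x-rep y-rep
      ... | no x-nonrep  | no y-nonrep  =
        proj₂ (±-unique (*-cancelˡ ε ε≉0 (+-cancelˡ c _ _ hx≈hy))) x-nonrep y-nonrep
      ... | yes _        | no _         = ⊥-elim (non-norm x y hx≈hy)
      ... | no _         | yes _        = ⊥-elim (non-norm y x (sym hx≈hy))

      h-avoids-c : ∀ x → ¬ h x ≈ c
      h-avoids-c x hx≈c with Rep? x
      ... | yes _ = non-norm x 0# (trans hx≈c (solve 2 (λ c ε → c := c :+ ε :* (:0 :* :0)) refl c ε))
      ... | no x-nonrep =
        x-nonrep (Rep-0 (x*x≈0⇒x≈0 _≟_ x (*-cancelˡ ε ε≉0 (+-cancelˡ c _ _ εxx≈ε0))))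
        where
        εxx≈ε0 : c + ε * (x * x) ≈ c + ε * 0#
        εxx≈ε0 = trans hx≈c (solve 2 (λ c ε → c := c :+ ε :* :0) refl c ε)

    norm-surjective : ∀ c → ∃ λ u → norm u ≈ c
    norm-surjective c with Fin.any? (λ i → Fin.any? (λ j → to i * to i ≟ c + ε * (to j * to j)))
    ... | yes (i , j , ii≈c+εjj) = (to i , to j) ,
      trans (+-congʳ ii≈c+εjj) (solve 2 (λ c t → c :+ t :- t := c) refl c (ε * (to j * to j)))
    ... | no ∄ij = ⊥-elim (norm-covers c λ a b aa≈c+εbb →
      ∄ij (from a , from b ,
           trans (square-to-from a) (trans aa≈c+εbb (+-congˡ (*-congˡ (sym (square-to-from b)))))))
      where
      square-to-from : ∀ x → to (from x) * to (from x) ≈ x * x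
      square-to-from x = *-cong (strictlyInverseˡ x) (strictlyInverseˡ x)

module Lemma6p2 {c ℓ} (R : CommutativeRing c ℓ) (F : IsField R) {q : ℕ} (ord : HasOrder R q)
  (2≉0 : ¬ CommutativeRing._≈_ R (CommutativeRing._+_ R (CommutativeRing.1# R) (CommutativeRing.1# R))
                                  (CommutativeRing.0# R))
  (ε : CommutativeRing.Carrier R)
  (ε-nonsquare : ¬ ∃ λ y → CommutativeRing._≈_ R (CommutativeRing._*_ R y y) ε) where
  open CommutativeRing R
  open Heisenberg R F 2≉0 ε
  open CommutativeRingSolver R
  open QuadraticExtension R F ε
  open FiniteSetoid ord using (_≟_)

  module Gₛ = Setoid (On.setoid (setoid ×ₛ (setoid ×ₛ setoid)) (λ g → gx g , gy g , gz g))

  xy : G → Carrier × Carrier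
  xy g = gx g , gy g

  ≈G⇒xy≈ : ∀ {g h} → g ≈G h → xy g ≈² xy h
  ≈G⇒xy≈ (gx≈hx , gy≈hy , _) = gx≈hx , gy≈hy

  φ-cong : ∀ {α β α' β'} → α ≈ α' → β ≈ β' → ∀ g → φ α β g ≈G φ α' β' g
  φ-cong α≈α' β≈β' g =
    +-cong (*-congʳ α≈α') (*-congʳ (*-congˡ β≈β')) ,
    +-cong (*-congʳ β≈β') (*-congʳ α≈α') ,
    +-cong (+-cong (*-congʳ (*-cong α≈α' β≈β')) (*-congʳ (*-congˡ (*-cong β≈β' β≈β'))))
           (*-congʳ (+-cong (*-cong α≈α' α≈α') (-‿cong (*-congˡ (*-cong β≈β' β≈β')))))

  φ-centre : ∀ α β z → φ α β (mat 0# 0# z) ≈G mat 0# 0# (norm (α , β) * z)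
  φ-centre α β z =
    solve 3 (λ ε α β → α :* :0 :+ ε :* β :* :0 := :0) refl ε α β ,
    solve 2 (λ α β → β :* :0 :+ α :* :0 := :0) refl α β ,
    solve 5 (λ ε α β h z →
        α :* β :* (:0 :* :0 :* h :+ ε :* (:0 :* :0 :* h))
          :+ ε :* (β :* β) :* (:0 :* :0) :+ (α :* α :- ε :* (β :* β)) :* z
        := (α :* α :- ε :* (β :* β)) :* z) refl ε α β half z

  centre-orbit : ∀ h → InOrbit (mat 0# 0# 1#) h ⇔ (InZ h × ¬ h ≈G e)
  centre-orbit h = mk⇔ orbit⇒centre centre⇒orbit
    where
    orbit⇒centre : InOrbit (mat 0# 0# 1#) h → InZ h × ¬ h ≈G e
    orbit⇒centre (α , β , nonzero , φ≈h) =
      ².trans (².sym (≈G⇒xy≈ φ≈h)) (≈G⇒xy≈ centre) ,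
      λ h≈e → nonzero (norm≈0⇒≈0 ε-nonsquare _≟_ (trans (sym (*-identityʳ _))
                (trans (sym (centre .proj₂ .proj₂)) (trans (φ≈h .proj₂ .proj₂) (h≈e .proj₂ .proj₂)))))
      where
      centre = φ-centre α β 1#
    centre⇒orbit : InZ h × ¬ h ≈G e → InOrbit (mat 0# 0# 1#) h
    centre⇒orbit ((hx≈0 , hy≈0) , h≉e) with norm-surjective ord (ε≉0 ε-nonsquare) (gz h)
    ... | (α , β) , norm≈hz =
      α , β , (λ αβ≈0 → h≉e (hx≈0 , hy≈0 , trans (sym norm≈hz) (≈²0⇒norm≈0 αβ≈0))) ,
      Gₛ.trans (φ-centre α β 1#) (sym hx≈0 , sym hy≈0 , trans (*-identityʳ _) norm≈hz)

  coset⇒xy : ∀ {k t} → InCoset k t → xy t ≈² xy k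
  coset⇒xy (z , (zx≈0 , zy≈0) , (tx≈ , ty≈ , _)) =
    trans tx≈ (trans (+-congˡ zx≈0) (+-identityʳ _)) , trans ty≈ (trans (+-congˡ zy≈0) (+-identityʳ _))

  xy⇒coset : ∀ {k t} → xy t ≈² xy k → InCoset k t
  xy⇒coset {k} {t} (tx≈kx , ty≈ky) = mat 0# 0# (gz t - (gz k + gx k * 0#)) , (refl , refl) ,
    trans tx≈kx (sym (+-identityʳ _)) , trans ty≈ky (sym (+-identityʳ _)) ,
    solve 3 (λ t k w → t := k :+ (t :- (k :+ w)) :+ w) refl (gz t) (gz k) (gx k * 0#)

  module NonCentral (g : G) (orbit-avoids-Z : ∀ h → InOrbit g h → ¬ InZ h) where

    coordinates : ∀ {t} → InOrbit g t → Carrier × Carrier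
    coordinates (α , β , _) = α , β

    -- xy (φ α β g) is definitionally (α , β) ⊙ xy g: this is the action on G/Z.
    orbit⇒xy : ∀ {t} (o : InOrbit g t) → xy t ≈² coordinates o ⊙ xy g
    orbit⇒xy (_ , _ , _ , φ≈t) = ².sym (≈G⇒xy≈ φ≈t)

    xy≉0 : ¬ xy g ≈² (0# , 0#)
    xy≉0 xy≈0 = orbit-avoids-Z (φ 1# 0# g) (1# , 0# , (λ (1≈0 , _) → IsField.1≉0 F 1≈0) , Gₛ.refl)
                  (².trans (⊙-identityˡ (xy g)) xy≈0)

    norm-xy≉0 : ¬ norm (xy g) ≈ 0#
    norm-xy≉0 = xy≉0 ∘′ norm≈0⇒≈0 ε-nonsquare _≟_

    coordinates-unique : ∀ {t t'} (o : InOrbit g t) (o' : InOrbit g t') → xy t ≈² xy t' →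
                         coordinates o ≈² coordinates o'
    coordinates-unique o o' xyt≈xyt' = ⊙-cancelʳ (xy g) norm-xy≉0
      (².trans (².sym (orbit⇒xy o)) (².trans xyt≈xyt' (orbit⇒xy o')))

    transversal : IsTransversal (OrbitWithE g)
    transversal k = representative , unique
      where
      representative : Σ G λ t → OrbitWithE g t × InCoset k t
      representative with (gx k ≟ 0#) ×-dec (gy k ≟ 0#)
      ... | yes k∈Z = e , inj₂ (lift Gₛ.refl) , xy⇒coset (².sym k∈Z)
      ... | no k∉Z  = φ α β g , inj₁ (α , β , nonzero , Gₛ.refl) , xy⇒coset u⊙xy≈xyk
        where
        solution = ⊙-solvableʳ (xy g) norm-xy≉0 (xy k)
        α = proj₁ (proj₁ solution)
        β = proj₂ (proj₁ solution)
        u⊙xy≈xyk = proj₂ solution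
        nonzero : NonZeroPair α β
        nonzero u≈0 = k∉Z (².trans (².sym u⊙xy≈xyk) (².trans (⊙-congʳ (xy g) u≈0) (⊙-zeroˡ (xy g))))

      unique : ∀ t t' → OrbitWithE g t → OrbitWithE g t' → InCoset k t → InCoset k t' → t ≈G t'
      unique t t' t∈ t'∈ kt kt' = go t∈ t'∈ (².trans (coset⇒xy kt) (².sym (coset⇒xy kt')))
        where
        go : OrbitWithE g t → OrbitWithE g t' → xy t ≈² xy t' → t ≈G t'
        go (inj₁ o@(_ , _ , _ , φ≈t)) (inj₁ o'@(_ , _ , _ , φ'≈t')) xyt≈xyt' =
          Gₛ.trans (Gₛ.sym φ≈t) (Gₛ.trans (φ-cong α≈α' β≈β' g) φ'≈t')
          where
          α≈α' = proj₁ (coordinates-unique o o' xyt≈xyt')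
          β≈β' = proj₂ (coordinates-unique o o' xyt≈xyt')
        go (inj₁ t∈orbit) (inj₂ (lift t'≈e)) xyt≈xyt' =
          ⊥-elim (orbit-avoids-Z t t∈orbit (².trans xyt≈xyt' (≈G⇒xy≈ t'≈e)))
        go (inj₂ (lift t≈e)) (inj₁ t'∈orbit) xyt≈xyt' =
          ⊥-elim (orbit-avoids-Z t' t'∈orbit (².trans (².sym xyt≈xyt') (≈G⇒xy≈ t≈e)))
        go (inj₂ (lift t≈e)) (inj₂ (lift t'≈e)) _ = Gₛ.trans t≈e (Gₛ.sym t'≈e)

    orbit-inverse : Inverse ((setoid ×ₛ setoid) ∖ (0# , 0#)) (SubSetoid (InOrbit g))
    orbit-inverse = record
      { to        = λ ((α , β) , nonzero) → φ α β g , α , β , nonzero , Gₛ.refl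
      ; from      = λ (_ , o@(_ , _ , nonzero , _)) → coordinates o , nonzero
      ; to-cong   = λ (α≈α' , β≈β') → φ-cong α≈α' β≈β' g
      ; from-cong = λ {(_ , o)} {(_ , o')} h≈h' → coordinates-unique o o' (≈G⇒xy≈ h≈h')
      ; inverse   = (λ {(_ , _ , _ , _ , φ≈h)} (α'≈α , β'≈β) →
                       Gₛ.trans (φ-cong α'≈α β'≈β g) φ≈h)
                  , (λ {((α , β) , nonzero)} {(_ , o)} h≈φ →
                       coordinates-unique o (α , β , nonzero , Gₛ.refl) (≈G⇒xy≈ h≈φ))
      }

    orbit-size : HasSize (InOrbit g) (q ℕ.* q ℕ.∸ 1)
    orbit-size = Compose.inverse (punctured-square-inverse ord (0# , 0#)) orbit-inverse

open import Data.Nat using (_*_; _∸_)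

lemma6p2 : {c ℓ : Level} (R : CommutativeRing c ℓ) (F : IsField R) (q : ℕ)
    → HasOrder R q
    → (2≉0 : ¬ (CommutativeRing._≈_ R (CommutativeRing._+_ R (CommutativeRing.1# R) (CommutativeRing.1# R)) (CommutativeRing.0# R)))
    → (ε : CommutativeRing.Carrier R)
    → ¬ (∃ λ y → CommutativeRing._≈_ R (CommutativeRing._*_ R y y) ε)
    → let open Heisenberg R F 2≉0 ε in
      (Σ G λ g → (InZ g × ¬ (g ≈G e)) × (∀ h → InOrbit g h ⇔ (InZ h × ¬ (h ≈G e))))
      × (∀ g → (∀ h → InOrbit g h → ¬ InZ h)
           → IsTransversal (OrbitWithE g) × HasSize (InOrbit g) (q * q ∸ 1))
lemma6p2 R F q ord 2≉0 ε ε-nonsquare =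
  (mat 0# 0# 1# , ((refl , refl) , λ (_ , _ , 1≈0) → IsField.1≉0 F 1≈0) , centre-orbit) ,
  λ g orbit-avoids-Z → NonCentral.transversal g orbit-avoids-Z , NonCentral.orbit-size g orbit-avoids-Z
  where
  open CommutativeRing R using (0#; 1#; refl)
  open Heisenberg R F 2≉0 ε using (mat)
  open Lemma6p2 R F ord 2≉0 ε ε-nonsquare
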